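{- Fix $d\ge 1$ and a step set $\mathcal{S}\subseteq\{ -1,0,1\}^d\setminus\{\mathbf 0\}$ which is symmetric with respect to each axis (i.e. $(i_1,\dots,i_k,\dots,i_d)\in\mathcal{S}$ implies $(i_1,\dots,-i_k,\dots,i_d)\in\mathcal{S}$ for every $k$) and such that for every coordinate $k$ some step of $\mathcal{S}$ has $k$-th coordinate $1$. Let $F(\mathbf z,t)=\sum_{n\ge0}\sum_{\mathbf i\in\mathbb Z^d}s_{\mathbf i}(n)\mathbf z^{\mathbf i}t^n$, where $s_{\mathbf i}(n)$ is the number of walks of length $n$ from the origin with steps in $\mathcal{S}$ that never leave $\mathbb{Z}_{\ge0}^d$ and end at $\mathbf i$, and let $S(\mathbf z)=\sum_{\mathbf i\in\mathcal{S}}\mathbf z^{\mathbf i}$. Then $$F(\mathbf z,t)=[z_1^{\ge}]\cdots[z_d^{\ge}]\,R(\mathbf z,t),\qquad R(\mathbf z,t)=\frac{(z_1-z_1^{ -1})\cdots(z_d-z_d^{ -1})}{(z_1\cdots z_d)(1-tS(\mathbf z))},$$ where $R$ is expanded in $\mathbb{Q}[z_1,z_1^{ -1},\dots,z_d,z_d^{ -1}][[t]]$.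
   Context: $\mathbf z^{\mathbf i}=z_1^{i_1}\cdots z_d^{i_d}$. For $A(\mathbf z,t)\in\mathbb{Q}[z_1,z_1^{ -1},\dots,z_d,z_d^{ -1}][[t]]$, $[z_k^{\ge}]A(\mathbf z,t)$ denotes the sum of all terms of $A$ containing only non-negative powers of $z_k$. -}

module Defs where

open import Data.Nat using (ℕ; zero; suc)
open import Data.Integer as ℤ using (ℤ; +_; 0ℤ; 1ℤ; -1ℤ; _+_; _*_; -_; _≤_; _≤?_)
open import Data.Fin using (Fin)
open import Data.Vec as V using (Vec; lookup; replicate; zipWith; _[_]≔_)
open import Data.Vec.Properties using (≡-dec)
import Data.Vec.Relation.Unary.All as VAll
open import Data.List as L using (List; []; _∷_; [_]; map; concatMap; filter; foldr; foldl; scanl; allFin; length)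
import Data.List.Relation.Unary.All as LAll
open import Data.Product using (_×_; _,_)
open import Data.Sum using (_⊎_)
open import Relation.Nullary using (¬_; Dec; yes; no)
open import Relation.Nullary.Decidable using (_×-dec_)
open import Relation.Binary.PropositionalEquality using (_≡_)

Exp : ℕ → Set
Exp d = Vec ℤ d

_≟e_ : ∀ {d} (a b : Exp d) → Dec (a ≡ b)
_≟e_ = ≡-dec ℤ._≟_

origin : ∀ {d} → Exp d
origin {d} = replicate d 0ℤ

_+e_ : ∀ {d} → Exp d → Exp d → Exp d
_+e_ = zipWith _+_

-- Laurent polynomials in z_1..z_d with integer coefficients, represented as
-- finite formal sums of terms (exponent , coefficient).
LPoly : ℕ → Set
LPoly d = List (Exp d × ℤ)

coeff : ∀ {d} → LPoly d → Exp d → ℤ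
coeff [] i = 0ℤ
coeff ((e , c) ∷ p) i with e ≟e i
... | yes _ = c + coeff p i
... | no _ = coeff p i

oneL : ∀ {d} → LPoly d
oneL = [ (origin , 1ℤ) ]

monoL : ∀ {d} → Exp d → ℤ → LPoly d
monoL e c = [ (e , c) ]

_*L_ : ∀ {d} → LPoly d → LPoly d → LPoly d
p *L q = concatMap (λ { (e , c) → map (λ { (e' , c') → (e +e e' , c * c') }) q }) p

_^L_ : ∀ {d} → LPoly d → ℕ → LPoly d
p ^L zero = oneL
p ^L suc n = p *L (p ^L n)

unitE : ∀ {d} → Fin d → ℤ → Exp d
unitE k a = origin [ k ]≔ a

zMinusInv : ∀ {d} → Fin d → LPoly d
zMinusInv k = (unitE k 1ℤ , 1ℤ) ∷ (unitE k -1ℤ , -1ℤ) ∷ []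

numer : ∀ d → LPoly d
numer d = foldr _*L_ oneL (map zMinusInv (allFin d))

-- S(z) = Σ_{s ∈ S} z^s   (S given as a duplicate-free list)
stepPoly : ∀ {d} → List (Exp d) → LPoly d
stepPoly S = map (λ s → (s , 1ℤ)) S

-- R(z,t) = (z_1 - z_1^{-1})⋯(z_d - z_d^{-1}) / ((z_1⋯z_d)(1 - t S(z)))
-- expanded in ℤ[z^{±1}][[t]]: a power series in t is a map ℕ → LPoly d
-- (n ↦ coefficient of t^n), and 1/(1 - tS) = Σ_n S^n t^n.
R : ∀ {d} → List (Exp d) → ℕ → LPoly d
R {d} S n = (monoL (replicate d -1ℤ) 1ℤ *L numer d) *L (stepPoly S ^L n)

nonnegPart : ∀ {d} → Fin d → LPoly d → LPoly d
nonnegPart k p = filter (λ { (e , c) → 0ℤ ≤? lookup e k }) p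

nonnegAll : ∀ {d} → LPoly d → LPoly d
nonnegAll {d} p = foldr nonnegPart p (allFin d)

allWalks : ∀ {d} → List (Exp d) → ℕ → List (List (Exp d))
allWalks S zero = [ [] ]
allWalks S (suc n) = concatMap (λ s → map (s ∷_) (allWalks S n)) S

positions : ∀ {d} → List (Exp d) → List (Exp d)
positions w = scanl _+e_ origin w

endpoint : ∀ {d} → List (Exp d) → Exp d
endpoint w = foldl _+e_ origin w

InOrthant : ∀ {d} → Exp d → Set
InOrthant e = VAll.All (0ℤ ≤_) e

GoodWalk : ∀ {d} → Exp d → List (Exp d) → Set
GoodWalk i w = LAll.All InOrthant (positions w) × endpoint w ≡ i

goodWalk? : ∀ {d} (i : Exp d) (w : List (Exp d)) → Dec (GoodWalk i w)
goodWalk? i w = LAll.all? (VAll.all? (0ℤ ≤?_)) (positions w) ×-dec (endpoint w ≟e i)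

walkCount : ∀ {d} → List (Exp d) → ℕ → Exp d → ℕ
walkCount S n i = length (filter (goodWalk? i) (allWalks S n))

IsStep : ∀ {d} → Exp d → Set
IsStep s = VAll.All (λ x → x ≡ -1ℤ ⊎ x ≡ 0ℤ ⊎ x ≡ 1ℤ) s × ¬ (s ≡ origin)

flipE : ∀ {d} → Fin d → Exp d → Exp d
flipE k s = s [ k ]≔ (- lookup s k)

module Submission where

-- The coefficient r_n(i) of z^i t^n in R satisfies the walk recurrence r_{n+1}(i) = Σ_{s ∈ S} r_n(i − s),
-- since R is a fixed Laurent polynomial times Σ_n S^n t^n. Each reflection z_k ↦ z_k^{-1} fixes S, hence S^n,
-- but changes the sign of z_k − z_k^{-1}; after the shift by 1/(z_1 ⋯ z_d) this makes r_n vanish on every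
-- hyperplane i_k = −1, which is exactly where a step with entries in {−1, 0, 1} lands when it leaves the
-- orthant. At n = 0 only the leading monomial z_1 ⋯ z_d of the numerator survives on the orthant, so r_0 = δ_0
-- there. Hence on the orthant r_n obeys the recurrence and initial values of the number of walks confined to
-- it, and the extractions [z_k^≥] discard everything outside the orthant, where there are no such walks.

open import Defs
open import Data.Nat as ℕ using (ℕ; zero; suc; s≤s; z≤n)
open import Data.Nat.Properties using (m≤n+m)
open import Data.Integer as ℤ using (ℤ; +_; 0ℤ; 1ℤ; -1ℤ; _+_; _*_; _-_; _≤_; _≤?_)
import Data.Integer.Properties as ℤ
open import Data.Integer.Solver using (module +-*-Solver)
open +-*-Solver using (solve; _:=_; _:+_; _:-_; _:*_; :-_; con)
open import Data.Fin using (Fin)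
open import Data.Fin.Properties using (¬∀⟶∃¬)
open import Data.Vec as V using (lookup; []; _∷_)
import Data.Vec.Properties as V
import Data.Vec.Relation.Unary.All as VAll
import Data.Vec.Relation.Unary.All.Properties as VAll
open import Data.List as L using (List; []; _∷_; map; foldr; _++_; allFin)
import Data.List.Properties as L
import Data.List.Relation.Unary.All as All
open import Data.List.Relation.Unary.AllPairs using (_∷_)
open import Data.List.Relation.Unary.Any using (here; there)
open import Data.List.Membership.Propositional using (_∈_)
import Data.List.Membership.Propositional.Properties as ∈
open import Data.List.Membership.Propositional.Properties.WithK using (unique∧set⇒bag)
open import Data.List.Relation.Unary.Unique.Propositional using (Unique)
import Data.List.Relation.Unary.Unique.Propositional.Properties as Unique
open import Data.List.Relation.Binary.BagAndSetEquality using (∼bag⇒↭)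
open import Data.List.Relation.Binary.Permutation.Propositional using (_↭_; ↭⇒↭ₛ)
import Data.List.Relation.Binary.Permutation.Propositional.Properties as ↭
open import Data.List.Relation.Binary.Permutation.Setoid.Properties ℤ.≡-setoid using (foldr-commMonoid)
open import Data.Product using (_×_; _,_; proj₁; proj₂; ∃; ∃-syntax)
open import Data.Sum using (_⊎_; inj₁; inj₂)
open import Data.Empty using (⊥-elim)
open import Function.Bundles using (mk⇔)
open import Level using (Level)
open import Relation.Nullary using (¬_; Dec; yes; no)
open import Relation.Nullary.Decidable using (_×-dec_)
open import Relation.Unary using (Pred; Decidable)
open import Relation.Binary.PropositionalEquality

private variable
  d : ℕ
  a : Level
  A B : Set a

_-e_ : Exp d → Exp d → Exp d
_-e_ = V.zipWith _-_

Exp-ext : {x y : Exp d} → (∀ k → lookup x k ≡ lookup y k) → x ≡ y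
Exp-ext {x = x} {y} x≗y = trans (sym (V.tabulate∘lookup x)) (trans (V.tabulate-cong x≗y) (V.tabulate∘lookup y))

+e-comm : (x y : Exp d) → x +e y ≡ y +e x
+e-comm = V.zipWith-comm ℤ.+-comm

-e-+e : (y e e′ : Exp d) → y -e (e +e e′) ≡ (y -e e) -e e′
-e-+e [] [] [] = refl
-e-+e (a ∷ y) (b ∷ e) (c ∷ e′) =
  cong₂ _∷_ (solve 3 (λ a b c → a :- (b :+ c) := (a :- b) :- c) refl a b c) (-e-+e y e e′)

-e-swap : (y e e′ : Exp d) → (y -e e) -e e′ ≡ (y -e e′) -e e
-e-swap [] [] [] = refl
-e-swap (a ∷ y) (b ∷ e) (c ∷ e′) =
  cong₂ _∷_ (solve 3 (λ a b c → (a :- b) :- c := (a :- c) :- b) refl a b c) (-e-swap y e e′)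

-e-identityʳ : (y : Exp d) → y -e origin ≡ y
-e-identityʳ [] = refl
-e-identityʳ (a ∷ y) = cong₂ _∷_ (ℤ.+-identityʳ a) (-e-identityʳ y)

+e--e-cancelʳ : (x e : Exp d) → (x +e e) -e e ≡ x
+e--e-cancelʳ [] [] = refl
+e--e-cancelʳ (a ∷ x) (b ∷ e) = cong₂ _∷_ (solve 2 (λ a b → (a :+ b) :- b := a) refl a b) (+e--e-cancelʳ x e)

-e-+e-cancelʳ : (y e : Exp d) → (y -e e) +e e ≡ y
-e-+e-cancelʳ [] [] = refl
-e-+e-cancelʳ (a ∷ y) (b ∷ e) = cong₂ _∷_ (solve 2 (λ a b → (a :- b) :+ b := a) refl a b) (-e-+e-cancelʳ y e)

+e≡⇔≡-e : (x e y : Exp d) → (x +e e ≡ y → x ≡ y -e e) × (x ≡ y -e e → x +e e ≡ y)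
+e≡⇔≡-e x e y = (λ { refl → sym (+e--e-cancelʳ x e) }) , (λ { refl → -e-+e-cancelʳ y e })

lookup--e : (x y : Exp d) (k : Fin d) → lookup (x -e y) k ≡ lookup x k - lookup y k
lookup--e x y k = V.lookup-zipWith _-_ k x y

lookup-origin : (k : Fin d) → lookup (origin {d}) k ≡ 0ℤ
lookup-origin k = V.lookup-replicate k 0ℤ

lookup-unitE : (k : Fin d) (a : ℤ) → lookup (unitE k a) k ≡ a
lookup-unitE k a = V.lookup∘update k origin a

lookup-unitE-≢ : {j k : Fin d} → j ≢ k → (a : ℤ) → lookup (unitE j a) k ≡ 0ℤ
lookup-unitE-≢ {k = k} j≢k a = trans (V.lookup∘update′ (λ k≡j → j≢k (sym k≡j)) origin a) (lookup-origin k)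

lookup--e-unitE : (k : Fin d) (a : ℤ) (y : Exp d) → lookup (y -e unitE k a) k ≡ lookup y k - a
lookup--e-unitE k a y = trans (lookup--e y _ k) (cong (_-_ (lookup y k)) (lookup-unitE k a))

lookup--e-unitE-≢ : {j k : Fin d} → j ≢ k → (a : ℤ) (y : Exp d) → lookup (y -e unitE j a) k ≡ lookup y k
lookup--e-unitE-≢ {k = k} j≢k a y =
  trans (lookup--e y _ k) (trans (cong (_-_ (lookup y k)) (lookup-unitE-≢ j≢k a)) (ℤ.+-identityʳ _))

flipE-involutive : (k : Fin d) (x : Exp d) → flipE k (flipE k x) ≡ x
flipE-involutive Fin.zero (a ∷ x) = cong (_∷ x) (ℤ.neg-involutive a)
flipE-involutive (Fin.suc k) (a ∷ x) = cong (a ∷_) (flipE-involutive k x)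

flipE--e : (k : Fin d) (x e : Exp d) → flipE k (x -e e) ≡ flipE k x -e flipE k e
flipE--e Fin.zero (a ∷ x) (b ∷ e) = cong (_∷ (x -e e)) (solve 2 (λ a b → :- (a :- b) := (:- a) :- (:- b)) refl a b)
flipE--e (Fin.suc k) (a ∷ x) (b ∷ e) = cong (a - b ∷_) (flipE--e k x e)

flipE-fixed : (k : Fin d) (x : Exp d) → lookup x k ≡ 0ℤ → flipE k x ≡ x
flipE-fixed Fin.zero (.0ℤ ∷ x) refl = refl
flipE-fixed (Fin.suc k) (a ∷ x) xₖ≡0 = cong (a ∷_) (flipE-fixed k x xₖ≡0)

-e-unitE-mirror : (k : Fin d) (y : Exp d) → lookup y k ≡ 0ℤ → y -e unitE k 1ℤ ≡ flipE k (y -e unitE k -1ℤ)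
-e-unitE-mirror Fin.zero (.0ℤ ∷ y) refl = refl
-e-unitE-mirror (Fin.suc k) (a ∷ y) yₖ≡0 = cong (a - 0ℤ ∷_) (-e-unitE-mirror k y yₖ≡0)

sumMap : List A → (A → ℤ) → ℤ
sumMap xs f = foldr _+_ 0ℤ (map f xs)

sumMap-cong : (xs : List A) {f g : A → ℤ} → (∀ x → x ∈ xs → f x ≡ g x) → sumMap xs f ≡ sumMap xs g
sumMap-cong [] eq = refl
sumMap-cong (x ∷ xs) eq = cong₂ _+_ (eq x (here refl)) (sumMap-cong xs (λ y y∈xs → eq y (there y∈xs)))

sumMap-zero : (xs : List A) → sumMap xs (λ _ → 0ℤ) ≡ 0ℤ
sumMap-zero [] = refl
sumMap-zero (x ∷ xs) = trans (ℤ.+-identityˡ _) (sumMap-zero xs)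

sumMap-++ : (xs ys : List A) (f : A → ℤ) → sumMap (xs ++ ys) f ≡ sumMap xs f + sumMap ys f
sumMap-++ [] ys f = sym (ℤ.+-identityˡ _)
sumMap-++ (x ∷ xs) ys f = trans (cong (_+_ (f x)) (sumMap-++ xs ys f)) (sym (ℤ.+-assoc (f x) _ _))

sumMap-map : (g : A → B) (xs : List A) (f : B → ℤ) → sumMap (map g xs) f ≡ sumMap xs (λ x → f (g x))
sumMap-map g xs f = cong (foldr _+_ 0ℤ) (sym (L.map-∘ xs))

sumMap-concatMap : (g : A → List B) (xs : List A) (f : B → ℤ)
  → sumMap (L.concatMap g xs) f ≡ sumMap xs (λ x → sumMap (g x) f)
sumMap-concatMap g [] f = refl
sumMap-concatMap g (x ∷ xs) f = trans (sumMap-++ (g x) _ f) (cong (_+_ (sumMap (g x) f)) (sumMap-concatMap g xs f))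

sumMap-*ˡ : (c : ℤ) (xs : List A) (f : A → ℤ) → sumMap xs (λ x → c * f x) ≡ c * sumMap xs f
sumMap-*ˡ c [] f = sym (ℤ.*-zeroʳ c)
sumMap-*ˡ c (x ∷ xs) f = trans (cong (_+_ (c * f x)) (sumMap-*ˡ c xs f)) (sym (ℤ.*-distribˡ-+ c (f x) _))

sumMap-+ : (xs : List A) (f g : A → ℤ) → sumMap xs (λ x → f x + g x) ≡ sumMap xs f + sumMap xs g
sumMap-+ [] f g = refl
sumMap-+ (x ∷ xs) f g = trans (cong (_+_ (f x + g x)) (sumMap-+ xs f g))
  (solve 4 (λ a b c e → (a :+ b) :+ (c :+ e) := (a :+ c) :+ (b :+ e)) refl (f x) (g x) (sumMap xs f) (sumMap xs g))

sumMap-swap : (xs : List A) (ys : List B) (F : A → B → ℤ)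
  → sumMap xs (λ x → sumMap ys (F x)) ≡ sumMap ys (λ y → sumMap xs (λ x → F x y))
sumMap-swap [] ys F = sym (sumMap-zero ys)
sumMap-swap (x ∷ xs) ys F = trans (cong (_+_ (sumMap ys (F x))) (sumMap-swap xs ys F))
  (sym (sumMap-+ ys (F x) (λ y → sumMap xs (λ x → F x y))))

sumMap-↭ : {xs ys : List A} (f : A → ℤ) → xs ↭ ys → sumMap xs f ≡ sumMap ys f
sumMap-↭ f xs↭ys = foldr-commMonoid ℤ.+-0-isCommutativeMonoid (↭⇒↭ₛ (↭.map⁺ f xs↭ys))

sumMap-reindex : {xs : List A} (σ : A → A) (f : A → ℤ) → (∀ x → σ (σ x) ≡ x) → Unique xs
  → (∀ x → x ∈ xs → σ x ∈ xs) → sumMap xs (λ x → f (σ x)) ≡ sumMap xs f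
sumMap-reindex {xs = xs} σ f σ-involutive xs-unique σ-closed =
  trans (sym (sumMap-map σ xs f)) (sumMap-↭ f (∼bag⇒↭ (unique∧set⇒bag σxs-unique xs-unique (mk⇔ to from))))
  where
  σxs-unique : Unique (map σ xs)
  σxs-unique = Unique.map⁺ (λ {x} {y} σx≡σy → trans (sym (σ-involutive x)) (trans (cong σ σx≡σy) (σ-involutive y)))
                           xs-unique
  to : ∀ {x} → x ∈ map σ xs → x ∈ xs
  to x∈σxs with ∈.∈-map⁻ σ x∈σxs
  ... | y , y∈xs , refl = σ-closed y y∈xs
  from : ∀ {x} → x ∈ xs → x ∈ map σ xs
  from {x} x∈xs = subst (_∈ map σ xs) (σ-involutive x) (∈.∈-map⁺ σ (σ-closed x x∈xs))

𝟙 : {P : Set a} → Dec P → ℤ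
𝟙 (yes _) = 1ℤ
𝟙 (no _) = 0ℤ

𝟙-yes : {P : Set a} (p : Dec P) → P → 𝟙 p ≡ 1ℤ
𝟙-yes (yes _) _ = refl
𝟙-yes (no ¬p) p = ⊥-elim (¬p p)

𝟙-no : {P : Set a} (p : Dec P) → ¬ P → 𝟙 p ≡ 0ℤ
𝟙-no (yes p) ¬p = ⊥-elim (¬p p)
𝟙-no (no _) _ = refl

𝟙-⇔ : {P Q : Set a} → (P → Q) → (Q → P) → (p : Dec P) (q : Dec Q) → 𝟙 p ≡ 𝟙 q
𝟙-⇔ P→Q Q→P (yes _) (yes _) = refl
𝟙-⇔ P→Q Q→P (no _) (no _) = refl
𝟙-⇔ P→Q Q→P (yes p) (no ¬q) = ⊥-elim (¬q (P→Q p))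
𝟙-⇔ P→Q Q→P (no ¬p) (yes q) = ⊥-elim (¬p (Q→P q))

𝟙-×-dec : {P Q : Set a} (p : Dec P) (q : Dec Q) → 𝟙 (p ×-dec q) ≡ 𝟙 p * 𝟙 q
𝟙-×-dec (yes _) (yes _) = refl
𝟙-×-dec (yes _) (no _) = refl
𝟙-×-dec (no _) (yes _) = refl
𝟙-×-dec (no _) (no _) = refl

length-filter≡sumMap-𝟙 : {P : Pred A a} (P? : Decidable P) (xs : List A)
  → + L.length (L.filter P? xs) ≡ sumMap xs (λ x → 𝟙 (P? x))
length-filter≡sumMap-𝟙 P? [] = refl
length-filter≡sumMap-𝟙 P? (x ∷ xs) with P? x
... | yes _ = trans (ℤ.pos-+ 1 _) (cong (_+_ 1ℤ) (length-filter≡sumMap-𝟙 P? xs))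
... | no _ = trans (length-filter≡sumMap-𝟙 P? xs) (sym (ℤ.+-identityˡ _))

-- If f is the coefficient function of a series F, then p ⊛ f is that of p · F.
infixr 7 _⊛_
_⊛_ : LPoly d → (Exp d → ℤ) → Exp d → ℤ
(p ⊛ f) y = sumMap p (λ (e , c) → c * f (y -e e))

⊛-cong : (p : LPoly d) {f g : Exp d → ℤ} → (∀ z → f z ≡ g z) → ∀ y → (p ⊛ f) y ≡ (p ⊛ g) y
⊛-cong p f≗g y = sumMap-cong p (λ (e , c) _ → cong (c *_) (f≗g (y -e e)))

coeff-++ : (p q : LPoly d) (y : Exp d) → coeff (p ++ q) y ≡ coeff p y + coeff q y
coeff-++ [] q y = sym (ℤ.+-identityˡ _)
coeff-++ ((e , c) ∷ p) q y with e ≟e y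
... | yes _ = trans (cong (_+_ c) (coeff-++ p q y)) (sym (ℤ.+-assoc c _ _))
... | no _ = coeff-++ p q y

coeff-shift : (e : Exp d) (c : ℤ) (q : LPoly d) (y : Exp d)
  → coeff (map (λ (e′ , c′) → (e +e e′ , c * c′)) q) y ≡ c * coeff q (y -e e)
coeff-shift e c [] y = sym (ℤ.*-zeroʳ c)
coeff-shift e c ((e′ , c′) ∷ q) y with (e +e e′) ≟e y | e′ ≟e (y -e e)
... | yes _ | yes _ = trans (cong (_+_ (c * c′)) (coeff-shift e c q y)) (sym (ℤ.*-distribˡ-+ c c′ _))
... | yes e+e′≡y | no e′≢y-e = ⊥-elim (e′≢y-e (proj₁ (+e≡⇔≡-e e′ e y) (trans (+e-comm e′ e) e+e′≡y)))
... | no e+e′≢y | yes e′≡y-e = ⊥-elim (e+e′≢y (trans (+e-comm e e′) (proj₂ (+e≡⇔≡-e e′ e y) e′≡y-e)))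
... | no _ | no _ = coeff-shift e c q y

coeff-*L : (p q : LPoly d) (y : Exp d) → coeff (p *L q) y ≡ (p ⊛ coeff q) y
coeff-*L [] q y = refl
coeff-*L ((e , c) ∷ p) q y =
  trans (coeff-++ (map _ q) (p *L q) y) (cong₂ _+_ (coeff-shift e c q y) (coeff-*L p q y))

⊛-*L : (p q : LPoly d) (f : Exp d → ℤ) (y : Exp d) → ((p *L q) ⊛ f) y ≡ (p ⊛ q ⊛ f) y
⊛-*L [] q f y = refl
⊛-*L ((e , c) ∷ p) q f y = begin
  sumMap (map _ q ++ p *L q) F            ≡⟨ sumMap-++ (map _ q) (p *L q) F ⟩
  sumMap (map _ q) F + ((p *L q) ⊛ f) y   ≡⟨ cong₂ _+_ shifted (⊛-*L p q f y) ⟩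
  c * (q ⊛ f) (y -e e) + (p ⊛ q ⊛ f) y    ∎
  where
  open ≡-Reasoning
  F : Exp _ × ℤ → ℤ
  F (e′ , c′) = c′ * f (y -e e′)
  shifted : sumMap (map (λ (e′ , c′) → (e +e e′ , c * c′)) q) F ≡ c * (q ⊛ f) (y -e e)
  shifted = trans (sumMap-map _ q F) (trans (sumMap-cong q (λ (e′ , c′) _ →
      trans (ℤ.*-assoc c c′ _) (cong (λ z → c * (c′ * f z)) (-e-+e y e e′))))
    (sumMap-*ˡ c q _))

⊛-comm : (p q : LPoly d) (f : Exp d → ℤ) (y : Exp d) → (p ⊛ q ⊛ f) y ≡ (q ⊛ p ⊛ f) y
⊛-comm p q f y = begin
  sumMap p (λ (e , c) → c * sumMap q (λ (e′ , c′) → c′ * f ((y -e e) -e e′)))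
    ≡⟨ sumMap-cong p (λ (e , c) _ → sym (sumMap-*ˡ c q _)) ⟩
  sumMap p (λ (e , c) → sumMap q (λ (e′ , c′) → c * (c′ * f ((y -e e) -e e′))))
    ≡⟨ sumMap-swap p q _ ⟩
  sumMap q (λ (e′ , c′) → sumMap p (λ (e , c) → c * (c′ * f ((y -e e) -e e′))))
    ≡⟨ sumMap-cong q (λ (e′ , c′) _ → sumMap-cong p (λ (e , c) _ → reorder e c e′ c′)) ⟩
  sumMap q (λ (e′ , c′) → sumMap p (λ (e , c) → c′ * (c * f ((y -e e′) -e e))))
    ≡⟨ sumMap-cong q (λ (e′ , c′) _ → sumMap-*ˡ c′ p _) ⟩
  sumMap q (λ (e′ , c′) → c′ * sumMap p (λ (e , c) → c * f ((y -e e′) -e e)))  ∎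
  where
  open ≡-Reasoning
  reorder : ∀ e c e′ c′ → c * (c′ * f ((y -e e) -e e′)) ≡ c′ * (c * f ((y -e e′) -e e))
  reorder e c e′ c′ rewrite -e-swap y e e′ =
    solve 3 (λ a b x → a :* (b :* x) := b :* (a :* x)) refl c c′ (f ((y -e e′) -e e))

zMinusInvProd : List (Fin d) → LPoly d
zMinusInvProd ks = foldr _*L_ oneL (map zMinusInv ks)

Δ : List (Fin d) → (Exp d → ℤ) → Exp d → ℤ
Δ ks = zMinusInvProd ks ⊛_

Δ-[] : (f : Exp d → ℤ) (y : Exp d) → Δ [] f y ≡ f y
Δ-[] f y = trans (ℤ.+-identityʳ _) (trans (ℤ.*-identityˡ _) (cong f (-e-identityʳ y)))

Δ-∷ : (k : Fin d) (ks : List (Fin d)) (f : Exp d → ℤ) (y : Exp d)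
  → Δ (k ∷ ks) f y ≡ Δ ks f (y -e unitE k 1ℤ) - Δ ks f (y -e unitE k -1ℤ)
Δ-∷ k ks f y = trans (⊛-*L (zMinusInv k) (zMinusInvProd ks) f y)
  (solve 2 (λ a b → con 1ℤ :* a :+ (con -1ℤ :* b :+ con 0ℤ) := a :- b) refl
    (Δ ks f (y -e unitE k 1ℤ)) (Δ ks f (y -e unitE k -1ℤ)))

Δ-flipE-invariant : (ks : List (Fin d)) (k : Fin d) (g : Exp d → ℤ) → ¬ k ∈ ks
  → (∀ y → g (flipE k y) ≡ g y) → ∀ y → Δ ks g (flipE k y) ≡ Δ ks g y
Δ-flipE-invariant [] k g k∉ks g-inv y = trans (Δ-[] g _) (trans (g-inv y) (sym (Δ-[] g y)))
Δ-flipE-invariant (j ∷ ks) k g k∉j∷ks g-inv y = begin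
  Δ (j ∷ ks) g (flipE k y)                                             ≡⟨ Δ-∷ j ks g _ ⟩
  Δ ks g (flipE k y -e unitE j 1ℤ) - Δ ks g (flipE k y -e unitE j -1ℤ) ≡⟨ cong₂ _-_ (shift 1ℤ) (shift -1ℤ) ⟩
  Δ ks g (y -e unitE j 1ℤ) - Δ ks g (y -e unitE j -1ℤ)                 ≡⟨ Δ-∷ j ks g y ⟨
  Δ (j ∷ ks) g y                                                       ∎
  where
  open ≡-Reasoning
  j≢k : j ≢ k
  j≢k j≡k = k∉j∷ks (here (sym j≡k))
  shift : ∀ a → Δ ks g (flipE k y -e unitE j a) ≡ Δ ks g (y -e unitE j a)
  shift a = begin
    Δ ks g (flipE k y -e unitE j a)             ≡⟨ cong (λ e → Δ ks g (flipE k y -e e)) (flipE-fixed k _ (lookup-unitE-≢ j≢k a)) ⟨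
    Δ ks g (flipE k y -e flipE k (unitE j a))   ≡⟨ cong (Δ ks g) (flipE--e k y (unitE j a)) ⟨
    Δ ks g (flipE k (y -e unitE j a))           ≡⟨ Δ-flipE-invariant ks k g (λ k∈ks → k∉j∷ks (there k∈ks)) g-inv _ ⟩
    Δ ks g (y -e unitE j a)                     ∎

-- The reflection exchanges the two terms of z_k − z_k^{-1} and fixes the remaining factors.
Δ-vanishes-on-wall : (ks : List (Fin d)) (k : Fin d) (g : Exp d → ℤ) → Unique ks → k ∈ ks
  → (∀ y → g (flipE k y) ≡ g y) → ∀ y → lookup y k ≡ 0ℤ → Δ ks g y ≡ 0ℤ
Δ-vanishes-on-wall (.k ∷ ks) k g (k∉ks ∷ _) (here refl) g-inv y yₖ≡0 = begin
  Δ (k ∷ ks) g y                                ≡⟨ Δ-∷ k ks g y ⟩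
  Δ ks g (y -e unitE k 1ℤ) - Δ ks g y⁺          ≡⟨ cong (λ z → Δ ks g z - Δ ks g y⁺) (-e-unitE-mirror k y yₖ≡0) ⟩
  Δ ks g (flipE k y⁺) - Δ ks g y⁺               ≡⟨ cong (_- Δ ks g y⁺) (Δ-flipE-invariant ks k g k∉ks′ g-inv y⁺) ⟩
  Δ ks g y⁺ - Δ ks g y⁺                         ≡⟨ ℤ.+-inverseʳ (Δ ks g y⁺) ⟩
  0ℤ                                            ∎
  where
  open ≡-Reasoning
  y⁺ : Exp _
  y⁺ = y -e unitE k -1ℤ
  k∉ks′ : ¬ k ∈ ks
  k∉ks′ k∈ks = All.lookup k∉ks k∈ks refl
Δ-vanishes-on-wall (j ∷ ks) k g (j∉ks ∷ ks-unique) (there k∈ks) g-inv y yₖ≡0 =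
  trans (Δ-∷ j ks g y) (cong₂ _-_ (on-wall 1ℤ) (on-wall -1ℤ))
  where
  on-wall : ∀ a → Δ ks g (y -e unitE j a) ≡ 0ℤ
  on-wall a = Δ-vanishes-on-wall ks k g ks-unique k∈ks g-inv _
    (trans (lookup--e-unitE-≢ (All.lookup j∉ks k∈ks) a y) yₖ≡0)

unitSum : List (Fin d) → Exp d
unitSum [] = origin
unitSum (k ∷ ks) = unitSum ks +e unitE k 1ℤ

lookup-unitSum-∉ : (ks : List (Fin d)) (k : Fin d) → ¬ k ∈ ks → lookup (unitSum ks) k ≡ 0ℤ
lookup-unitSum-∉ [] k _ = lookup-origin k
lookup-unitSum-∉ (j ∷ ks) k k∉j∷ks = trans (V.lookup-zipWith _+_ k (unitSum ks) _)
  (cong₂ _+_ (lookup-unitSum-∉ ks k (λ k∈ks → k∉j∷ks (there k∈ks)))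
             (lookup-unitE-≢ (λ j≡k → k∉j∷ks (here (sym j≡k))) 1ℤ))

lookup-unitSum-∈ : (ks : List (Fin d)) (k : Fin d) → Unique ks → k ∈ ks → lookup (unitSum ks) k ≡ 1ℤ
lookup-unitSum-∈ (.k ∷ ks) k (k∉ks ∷ _) (here refl) = trans (V.lookup-zipWith _+_ k (unitSum ks) _)
  (cong₂ _+_ (lookup-unitSum-∉ ks k (λ k∈ks → All.lookup k∉ks k∈ks refl)) (lookup-unitE k 1ℤ))
lookup-unitSum-∈ (j ∷ ks) k (j∉ks ∷ ks-unique) (there k∈ks) = trans (V.lookup-zipWith _+_ k (unitSum ks) _)
  (cong₂ _+_ (lookup-unitSum-∈ ks k ks-unique k∈ks) (lookup-unitE-≢ (All.lookup j∉ks k∈ks) 1ℤ))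

coeff-oneL : (y : Exp d) → coeff oneL y ≡ 𝟙 (origin ≟e y)
coeff-oneL y with origin ≟e y
... | yes _ = refl
... | no _ = refl

coeff-oneL-off-origin : (y : Exp d) (k : Fin d) → lookup y k ≢ 0ℤ → coeff oneL y ≡ 0ℤ
coeff-oneL-off-origin y k yₖ≢0 = trans (coeff-oneL y) (𝟙-no (origin ≟e y) (λ { refl → yₖ≢0 (lookup-origin k) }))

-- Any other term of the product has exponent −1 at some k ∈ ks, where y minus it is ≥ 2: it misses the constant term.
Δ-oneL-on-cone : (ks : List (Fin d)) → Unique ks → (y : Exp d) → (∀ k → k ∈ ks → + 1 ≤ lookup y k)
  → Δ ks (coeff oneL) y ≡ coeff oneL (y -e unitSum ks)
Δ-oneL-on-cone [] _ y _ = trans (Δ-[] (coeff oneL) y) (cong (coeff oneL) (sym (-e-identityʳ y)))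
Δ-oneL-on-cone (k ∷ ks) (k∉ks ∷ ks-unique) y y>0 = begin
  Δ (k ∷ ks) (coeff oneL) y                                      ≡⟨ Δ-∷ k ks (coeff oneL) y ⟩
  Δ ks (coeff oneL) (y -e unitE k 1ℤ) - Δ ks (coeff oneL) y⁺       ≡⟨ cong₂ _-_ (Δ-oneL-on-cone ks ks-unique _ (still>0 1ℤ))
                                                                                (Δ-oneL-on-cone ks ks-unique _ (still>0 -1ℤ)) ⟩
  coeff oneL ((y -e unitE k 1ℤ) -e unitSum ks) - coeff oneL (y⁺ -e unitSum ks)
                                                                 ≡⟨ cong₂ _-_ (cong (coeff oneL) (-e-swap y _ _))
                                                                              (coeff-oneL-off-origin _ k y⁺ₖ≢0) ⟩
  coeff oneL ((y -e unitSum ks) -e unitE k 1ℤ) - 0ℤ               ≡⟨ ℤ.+-identityʳ _ ⟩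
  coeff oneL ((y -e unitSum ks) -e unitE k 1ℤ)                    ≡⟨ cong (coeff oneL) (-e-+e y (unitSum ks) _) ⟨
  coeff oneL (y -e unitSum (k ∷ ks))                              ∎
  where
  open ≡-Reasoning
  y⁺ : Exp _
  y⁺ = y -e unitE k -1ℤ
  k∉ks′ : ¬ k ∈ ks
  k∉ks′ k∈ks = All.lookup k∉ks k∈ks refl
  still>0 : ∀ a j → j ∈ ks → + 1 ≤ lookup (y -e unitE k a) j
  still>0 a j j∈ks = subst (+ 1 ≤_) (sym (lookup--e-unitE-≢ (λ { refl → k∉ks′ j∈ks }) a y)) (y>0 j (there j∈ks))
  plus-one≢0 : ∀ {b} → + 1 ≤ b → b - -1ℤ ≢ 0ℤ
  plus-one≢0 (ℤ.+≤+ (s≤s _)) ()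
  y⁺ₖ≢0 : lookup (y⁺ -e unitSum ks) k ≢ 0ℤ
  y⁺ₖ≢0 = subst (_≢ 0ℤ) (sym (begin
    lookup (y⁺ -e unitSum ks) k             ≡⟨ lookup--e y⁺ (unitSum ks) k ⟩
    lookup y⁺ k - lookup (unitSum ks) k     ≡⟨ cong₂ _-_ (lookup--e-unitE k -1ℤ y) (lookup-unitSum-∉ ks k k∉ks′) ⟩
    (lookup y k - -1ℤ) - 0ℤ                 ≡⟨ ℤ.+-identityʳ _ ⟩
    lookup y k - -1ℤ                        ∎)) (plus-one≢0 (y>0 k (here refl)))

module _ {P : Pred (Exp d) a} (P? : Decidable P) where

  coeff-filter-∈ : (p : LPoly d) (y : Exp d) → P y → coeff (L.filter (λ t → P? (proj₁ t)) p) y ≡ coeff p y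
  coeff-filter-∈ [] y _ = refl
  coeff-filter-∈ ((e , c) ∷ p) y Py with P? e
  ... | yes _ with e ≟e y
  ...   | yes _ = cong (_+_ c) (coeff-filter-∈ p y Py)
  ...   | no _ = coeff-filter-∈ p y Py
  coeff-filter-∈ ((e , c) ∷ p) y Py | no ¬Pe with e ≟e y
  ...   | yes refl = ⊥-elim (¬Pe Py)
  ...   | no _ = coeff-filter-∈ p y Py

  coeff-filter-∉ : (p : LPoly d) (y : Exp d) → ¬ P y → coeff (L.filter (λ t → P? (proj₁ t)) p) y ≡ 0ℤ
  coeff-filter-∉ [] y _ = refl
  coeff-filter-∉ ((e , c) ∷ p) y ¬Py with P? e
  ... | no _ = coeff-filter-∉ p y ¬Py
  ... | yes Pe with e ≟e y
  ...   | yes refl = ⊥-elim (¬Py Pe)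
  ...   | no _ = coeff-filter-∉ p y ¬Py

coeff-nonnegPart-≥ : (k : Fin d) (p : LPoly d) (y : Exp d) → 0ℤ ≤ lookup y k → coeff (nonnegPart k p) y ≡ coeff p y
coeff-nonnegPart-≥ k = coeff-filter-∈ (λ e → 0ℤ ≤? lookup e k)

coeff-nonnegPart-< : (k : Fin d) (p : LPoly d) (y : Exp d) → ¬ 0ℤ ≤ lookup y k → coeff (nonnegPart k p) y ≡ 0ℤ
coeff-nonnegPart-< k = coeff-filter-∉ (λ e → 0ℤ ≤? lookup e k)

coeff-nonnegParts-≥ : (ks : List (Fin d)) (p : LPoly d) (y : Exp d) → (∀ k → 0ℤ ≤ lookup y k)
  → coeff (foldr nonnegPart p ks) y ≡ coeff p y
coeff-nonnegParts-≥ [] p y y≥0 = refl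
coeff-nonnegParts-≥ (k ∷ ks) p y y≥0 =
  trans (coeff-nonnegPart-≥ k (foldr nonnegPart p ks) y (y≥0 k)) (coeff-nonnegParts-≥ ks p y y≥0)

coeff-nonnegParts-< : (ks : List (Fin d)) (p : LPoly d) (y : Exp d) (k : Fin d) → k ∈ ks → ¬ 0ℤ ≤ lookup y k
  → coeff (foldr nonnegPart p ks) y ≡ 0ℤ
coeff-nonnegParts-< (k ∷ ks) p y .k (here refl) yₖ<0 = coeff-nonnegPart-< k (foldr nonnegPart p ks) y yₖ<0
coeff-nonnegParts-< (j ∷ ks) p y k (there k∈ks) yₖ<0 with 0ℤ ≤? lookup y j
... | yes yⱼ≥0 = trans (coeff-nonnegPart-≥ j (foldr nonnegPart p ks) y yⱼ≥0) (coeff-nonnegParts-< ks p y k k∈ks yₖ<0)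
... | no yⱼ<0 = coeff-nonnegPart-< j (foldr nonnegPart p ks) y yⱼ<0

inOrthant? : (a : Exp d) → Dec (InOrthant a)
inOrthant? a = VAll.all? (0ℤ ≤?_) a

¬inOrthant⇒negative : (a : Exp d) → ¬ InOrthant a → ∃ λ k → ¬ 0ℤ ≤ lookup a k
¬inOrthant⇒negative {d} a ¬a≥0 = ¬∀⟶∃¬ d _ (λ k → 0ℤ ≤? lookup a k) (λ a≥0 → ¬a≥0 (VAll.lookup⁻ a≥0))

origin-inOrthant : InOrthant (origin {d})
origin-inOrthant = VAll.lookup⁻ (λ k → subst (0ℤ ≤_) (sym (lookup-origin k)) (ℤ.≤-refl))

step-out-of-orthant : (i s : Exp d) → InOrthant i → IsStep s → ¬ InOrthant (i -e s)
  → ∃ λ k → lookup (i -e s) k ≡ -1ℤ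
step-out-of-orthant i s i≥0 (s∈[-1,1] , _) i-s≱0 with ¬inOrthant⇒negative (i -e s) i-s≱0
... | k , i-sₖ<0 = k , trans (lookup--e i s k)
  (just-below (VAll.lookup⁺ i≥0 k) (VAll.lookup⁺ s∈[-1,1] k) (subst (λ x → ¬ 0ℤ ≤ x) (lookup--e i s k) i-sₖ<0))
  where
  just-below : ∀ {a b} → 0ℤ ≤ a → b ≡ -1ℤ ⊎ b ≡ 0ℤ ⊎ b ≡ 1ℤ → ¬ 0ℤ ≤ a - b → a - b ≡ -1ℤ
  just-below (ℤ.+≤+ _) (inj₁ refl) a-b<0 = ⊥-elim (a-b<0 (ℤ.+≤+ z≤n))
  just-below (ℤ.+≤+ _) (inj₂ (inj₁ refl)) a-b<0 = ⊥-elim (a-b<0 (ℤ.+≤+ z≤n))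
  just-below (ℤ.+≤+ {n = zero} _) (inj₂ (inj₂ refl)) a-b<0 = refl
  just-below (ℤ.+≤+ {n = suc m} _) (inj₂ (inj₂ refl)) a-b<0 = ⊥-elim (a-b<0 (ℤ.+≤+ z≤n))

-- The exponent of the factor 1/(z_1 ⋯ z_d) of R.
minusOnes : Exp d
minusOnes {d} = V.replicate d -1ℤ

module _ (S : List (Exp d)) where

  powCoeff : ℕ → Exp d → ℤ
  powCoeff n = coeff (stepPoly S ^L n)

  stepPoly-⊛ : (f : Exp d → ℤ) (y : Exp d) → (stepPoly S ⊛ f) y ≡ sumMap S (λ s → f (y -e s))
  stepPoly-⊛ f y = trans (sumMap-map _ S _) (sumMap-cong S (λ s _ → ℤ.*-identityˡ _))

  powCoeff-suc : (n : ℕ) (y : Exp d) → powCoeff (suc n) y ≡ sumMap S (λ s → powCoeff n (y -e s))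
  powCoeff-suc n y = trans (coeff-*L (stepPoly S) _ y) (stepPoly-⊛ (powCoeff n) y)

  coeff-R : (n : ℕ) (i : Exp d) → coeff (R S n) i ≡ Δ (allFin d) (powCoeff n) (i -e minusOnes)
  coeff-R n i = begin
    coeff (R S n) i                                              ≡⟨ coeff-*L (monoL minusOnes 1ℤ *L numer d) _ i ⟩
    ((monoL minusOnes 1ℤ *L numer d) ⊛ powCoeff n) i             ≡⟨ ⊛-*L (monoL minusOnes 1ℤ) (numer d) (powCoeff n) i ⟩
    1ℤ * Δ (allFin d) (powCoeff n) (i -e minusOnes) + 0ℤ         ≡⟨ trans (ℤ.+-identityʳ _) (ℤ.*-identityˡ _) ⟩
    Δ (allFin d) (powCoeff n) (i -e minusOnes)                   ∎
    where open ≡-Reasoning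

  coeff-R-suc : (n : ℕ) (i : Exp d) → coeff (R S (suc n)) i ≡ sumMap S (λ s → coeff (R S n) (i -e s))
  coeff-R-suc n i = begin
    coeff (R S (suc n)) i                             ≡⟨ coeff-R (suc n) i ⟩
    Δ (allFin d) (powCoeff (suc n)) y                 ≡⟨ ⊛-cong (numer d) (coeff-*L (stepPoly S) _) y ⟩
    (numer d ⊛ stepPoly S ⊛ powCoeff n) y             ≡⟨ ⊛-comm (numer d) (stepPoly S) (powCoeff n) y ⟩
    (stepPoly S ⊛ Δₙ) y                               ≡⟨ stepPoly-⊛ Δₙ y ⟩
    sumMap S (λ s → Δₙ (y -e s))                      ≡⟨ sumMap-cong S (λ s _ → cong Δₙ (-e-swap i minusOnes s)) ⟩
    sumMap S (λ s → Δₙ ((i -e s) -e minusOnes))       ≡⟨ sumMap-cong S (λ s _ → coeff-R n (i -e s)) ⟨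
    sumMap S (λ s → coeff (R S n) (i -e s))           ∎
    where
    open ≡-Reasoning
    y : Exp d
    y = i -e minusOnes
    Δₙ : Exp d → ℤ
    Δₙ = Δ (allFin d) (powCoeff n)

  coeff-R-zero : (i : Exp d) → InOrthant i → coeff (R S 0) i ≡ coeff oneL i
  coeff-R-zero i i≥0 = begin
    coeff (R S 0) i                                          ≡⟨ coeff-R 0 i ⟩
    Δ (allFin d) (coeff oneL) (i -e minusOnes)               ≡⟨ Δ-oneL-on-cone (allFin d) (Unique.allFin⁺ d) _ shifted>0 ⟩
    coeff oneL ((i -e minusOnes) -e unitSum (allFin d))      ≡⟨ cong (coeff oneL) (Exp-ext shift-back) ⟩
    coeff oneL i                                             ∎
    where
    open ≡-Reasoning
    lookup-shifted : ∀ k → lookup (i -e minusOnes) k ≡ lookup i k - -1ℤ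
    lookup-shifted k = trans (lookup--e i _ k) (cong (_-_ (lookup i k)) (V.lookup-replicate k -1ℤ))
    shifted>0 : ∀ k → k ∈ allFin d → + 1 ≤ lookup (i -e minusOnes) k
    shifted>0 k _ = subst (+ 1 ≤_) (sym (lookup-shifted k)) (plus-one>0 (VAll.lookup⁺ i≥0 k))
      where
      plus-one>0 : ∀ {a} → 0ℤ ≤ a → + 1 ≤ a - -1ℤ
      plus-one>0 (ℤ.+≤+ {n = m} _) = ℤ.+≤+ (m≤n+m 1 m)
    shift-back : ∀ k → lookup ((i -e minusOnes) -e unitSum (allFin d)) k ≡ lookup i k
    shift-back k = begin
      lookup ((i -e minusOnes) -e unitSum (allFin d)) k
        ≡⟨ lookup--e (i -e minusOnes) (unitSum (allFin d)) k ⟩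
      lookup (i -e minusOnes) k - lookup (unitSum (allFin d)) k
        ≡⟨ cong₂ _-_ (lookup-shifted k) (lookup-unitSum-∈ (allFin d) k (Unique.allFin⁺ d) (∈.∈-allFin k)) ⟩
      (lookup i k - -1ℤ) - 1ℤ
        ≡⟨ solve 1 (λ a → (a :- con -1ℤ) :- con 1ℤ := a) refl (lookup i k) ⟩
      lookup i k ∎

  confinedWalks : ℕ → Exp d → Exp d → ℤ
  confinedWalks zero a i = 𝟙 (inOrthant? a) * 𝟙 (a ≟e i)
  confinedWalks (suc n) a i = 𝟙 (inOrthant? a) * sumMap S (λ s → confinedWalks n (a +e s) i)

  goodFrom? : (a i : Exp d) (w : List (Exp d)) → Dec (All.All InOrthant (L.scanl _+e_ a w) × L.foldl _+e_ a w ≡ i)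
  goodFrom? a i w = All.all? inOrthant? (L.scanl _+e_ a w) ×-dec (L.foldl _+e_ a w ≟e i)

  𝟙-goodFrom-[] : (a i : Exp d) → 𝟙 (goodFrom? a i []) ≡ 𝟙 (inOrthant? a) * 𝟙 (a ≟e i)
  𝟙-goodFrom-[] a i = trans
    (𝟙-⇔ (λ { (a≥0 All.∷ _ , a≡i) → a≥0 , a≡i }) (λ (a≥0 , a≡i) → a≥0 All.∷ All.[] , a≡i)
         (goodFrom? a i []) (inOrthant? a ×-dec (a ≟e i)))
    (𝟙-×-dec (inOrthant? a) (a ≟e i))

  𝟙-goodFrom-∷ : (a i s : Exp d) (w : List (Exp d))
    → 𝟙 (goodFrom? a i (s ∷ w)) ≡ 𝟙 (inOrthant? a) * 𝟙 (goodFrom? (a +e s) i w)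
  𝟙-goodFrom-∷ a i s w = trans
    (𝟙-⇔ (λ { (a≥0 All.∷ rest , end) → a≥0 , rest , end }) (λ (a≥0 , rest , end) → a≥0 All.∷ rest , end)
         (goodFrom? a i (s ∷ w)) (inOrthant? a ×-dec goodFrom? (a +e s) i w))
    (𝟙-×-dec (inOrthant? a) (goodFrom? (a +e s) i w))

  sumMap-𝟙-goodFrom : (n : ℕ) (a i : Exp d) → sumMap (allWalks S n) (λ w → 𝟙 (goodFrom? a i w)) ≡ confinedWalks n a i
  sumMap-𝟙-goodFrom zero a i = trans (ℤ.+-identityʳ _) (𝟙-goodFrom-[] a i)
  sumMap-𝟙-goodFrom (suc n) a i = begin
    sumMap (allWalks S (suc n)) (λ w → 𝟙 (goodFrom? a i w))
      ≡⟨ sumMap-concatMap (λ s → map (s ∷_) (allWalks S n)) S _ ⟩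
    sumMap S (λ s → sumMap (map (s ∷_) (allWalks S n)) (λ w → 𝟙 (goodFrom? a i w)))
      ≡⟨ sumMap-cong S (λ s _ → sumMap-map (s ∷_) (allWalks S n) _) ⟩
    sumMap S (λ s → sumMap (allWalks S n) (λ w → 𝟙 (goodFrom? a i (s ∷ w))))
      ≡⟨ sumMap-cong S (λ s _ → sumMap-cong (allWalks S n) (λ w _ → 𝟙-goodFrom-∷ a i s w)) ⟩
    sumMap S (λ s → sumMap (allWalks S n) (λ w → 𝟙 (inOrthant? a) * 𝟙 (goodFrom? (a +e s) i w)))
      ≡⟨ sumMap-cong S (λ s _ → sumMap-*ˡ (𝟙 (inOrthant? a)) (allWalks S n) _) ⟩
    sumMap S (λ s → 𝟙 (inOrthant? a) * sumMap (allWalks S n) (λ w → 𝟙 (goodFrom? (a +e s) i w)))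
      ≡⟨ sumMap-*ˡ (𝟙 (inOrthant? a)) S _ ⟩
    𝟙 (inOrthant? a) * sumMap S (λ s → sumMap (allWalks S n) (λ w → 𝟙 (goodFrom? (a +e s) i w)))
      ≡⟨ cong (𝟙 (inOrthant? a) *_) (sumMap-cong S (λ s _ → sumMap-𝟙-goodFrom n (a +e s) i)) ⟩
    confinedWalks (suc n) a i ∎
    where open ≡-Reasoning

  walkCount≡confinedWalks : (n : ℕ) (i : Exp d) → + walkCount S n i ≡ confinedWalks n origin i
  walkCount≡confinedWalks n i =
    trans (length-filter≡sumMap-𝟙 (goodWalk? i) (allWalks S n)) (sumMap-𝟙-goodFrom n origin i)

  confinedWalks-last-step : (n : ℕ) (a i : Exp d)
    → confinedWalks (suc n) a i ≡ 𝟙 (inOrthant? i) * sumMap S (λ s → confinedWalks n a (i -e s))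
  confinedWalks-last-step zero a i =
    trans (sym (sumMap-*ˡ (𝟙 (inOrthant? a)) S _))
          (trans (sumMap-cong S (λ s _ → single-step s)) (sumMap-*ˡ (𝟙 (inOrthant? i)) S _))
    where
    single-step : ∀ s → 𝟙 (inOrthant? a) * (𝟙 (inOrthant? (a +e s)) * 𝟙 ((a +e s) ≟e i))
                      ≡ 𝟙 (inOrthant? i) * (𝟙 (inOrthant? a) * 𝟙 (a ≟e (i -e s)))
    single-step s with (a +e s) ≟e i | a ≟e (i -e s)
    ... | yes refl | yes _ =
      solve 2 (λ x y → x :* (y :* con 1ℤ) := y :* (x :* con 1ℤ)) refl (𝟙 (inOrthant? a)) (𝟙 (inOrthant? (a +e s)))
    ... | yes refl | no a≢i-s = ⊥-elim (a≢i-s (sym (+e--e-cancelʳ a s)))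
    ... | no a+s≢i | yes refl = ⊥-elim (a+s≢i (-e-+e-cancelʳ i s))
    ... | no _ | no _ = solve 3 (λ x y z → x :* (y :* con 0ℤ) := z :* (x :* con 0ℤ)) refl
      (𝟙 (inOrthant? a)) (𝟙 (inOrthant? (a +e s))) (𝟙 (inOrthant? i))
  confinedWalks-last-step (suc n) a i = begin
    oa * sumMap S (λ s → confinedWalks (suc n) (a +e s) i)
      ≡⟨ cong (oa *_) (sumMap-cong S (λ s _ → confinedWalks-last-step n (a +e s) i)) ⟩
    oa * sumMap S (λ s → oi * sumMap S (λ t → G s t))
      ≡⟨ cong (oa *_) (sumMap-*ˡ oi S _) ⟩
    oa * (oi * sumMap S (λ s → sumMap S (λ t → G s t)))
      ≡⟨ cong (λ z → oa * (oi * z)) (sumMap-swap S S G) ⟩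
    oa * (oi * sumMap S (λ t → sumMap S (λ s → G s t)))
      ≡⟨ solve 3 (λ x y z → x :* (y :* z) := y :* (x :* z)) refl oa oi (sumMap S (λ t → sumMap S (λ s → G s t))) ⟩
    oi * (oa * sumMap S (λ t → sumMap S (λ s → G s t)))
      ≡⟨ cong (oi *_) (sumMap-*ˡ oa S (λ t → sumMap S (λ s → G s t))) ⟨
    oi * sumMap S (λ t → confinedWalks (suc n) a (i -e t)) ∎
    where
    open ≡-Reasoning
    oa oi : ℤ
    oa = 𝟙 (inOrthant? a)
    oi = 𝟙 (inOrthant? i)
    G : Exp d → Exp d → ℤ
    G s t = confinedWalks n (a +e s) (i -e t)

  confinedWalks-outside : (n : ℕ) (a i : Exp d) → ¬ InOrthant i → confinedWalks n a i ≡ 0ℤ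
  confinedWalks-outside zero a i i≱0 with a ≟e i
  ... | yes refl = cong (_* 1ℤ) (𝟙-no (inOrthant? a) i≱0)
  ... | no _ = ℤ.*-zeroʳ (𝟙 (inOrthant? a))
  confinedWalks-outside (suc n) a i i≱0 = trans (confinedWalks-last-step n a i)
    (cong (_* sumMap S (λ s → confinedWalks n a (i -e s))) (𝟙-no (inOrthant? i) i≱0))

  module _ (S-unique : Unique S) (S-symmetric : ∀ s → s ∈ S → (k : Fin d) → flipE k s ∈ S) where

    powCoeff-flipE : (n : ℕ) (k : Fin d) (y : Exp d) → powCoeff n (flipE k y) ≡ powCoeff n y
    powCoeff-flipE zero k y with origin ≟e flipE k y | origin ≟e y
    ... | yes _ | yes _ = refl
    ... | no _ | no _ = refl
    ... | yes 0≡y′ | no 0≢y = ⊥-elim (0≢y (begin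
      origin                   ≡⟨ flipE-fixed k origin (lookup-origin k) ⟨
      flipE k origin           ≡⟨ cong (flipE k) 0≡y′ ⟩
      flipE k (flipE k y)      ≡⟨ flipE-involutive k y ⟩
      y                        ∎))
      where open ≡-Reasoning
    ... | no 0≢y′ | yes refl = ⊥-elim (0≢y′ (sym (flipE-fixed k origin (lookup-origin k))))
    powCoeff-flipE (suc n) k y = begin
      powCoeff (suc n) (flipE k y)                 ≡⟨ powCoeff-suc n (flipE k y) ⟩
      sumMap S (λ s → powCoeff n (flipE k y -e s))   ≡⟨ sumMap-cong S (λ s _ → reflect s) ⟩
      sumMap S (λ s → powCoeff n (y -e flipE k s))   ≡⟨ sumMap-reindex (flipE k) (λ s → powCoeff n (y -e s))
                                                        (flipE-involutive k) S-unique (λ s s∈S → S-symmetric s s∈S k) ⟩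
      sumMap S (λ s → powCoeff n (y -e s))           ≡⟨ powCoeff-suc n y ⟨
      powCoeff (suc n) y                           ∎
      where
      open ≡-Reasoning
      reflect : ∀ s → powCoeff n (flipE k y -e s) ≡ powCoeff n (y -e flipE k s)
      reflect s = begin
        powCoeff n (flipE k y -e s)                     ≡⟨ cong (λ s′ → powCoeff n (flipE k y -e s′)) (flipE-involutive k s) ⟨
        powCoeff n (flipE k y -e flipE k (flipE k s))   ≡⟨ cong (powCoeff n) (flipE--e k y (flipE k s)) ⟨
        powCoeff n (flipE k (y -e flipE k s))           ≡⟨ powCoeff-flipE n k _ ⟩
        powCoeff n (y -e flipE k s)                     ∎

    coeff-R-on-wall : (n : ℕ) (j : Exp d) (k : Fin d) → lookup j k ≡ -1ℤ → coeff (R S n) j ≡ 0ℤ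
    coeff-R-on-wall n j k jₖ≡-1 =
      trans (coeff-R n j) (Δ-vanishes-on-wall (allFin d) k (powCoeff n) (Unique.allFin⁺ d) (∈.∈-allFin k)
        (powCoeff-flipE n k) (j -e minusOnes) shiftedₖ≡0)
      where
      shiftedₖ≡0 : lookup (j -e minusOnes) k ≡ 0ℤ
      shiftedₖ≡0 = trans (lookup--e j minusOnes k) (cong₂ _-_ jₖ≡-1 (V.lookup-replicate k -1ℤ))

    confinedWalks≡coeff-R : All.All IsStep S → (n : ℕ) (i : Exp d) → InOrthant i
      → confinedWalks n origin i ≡ coeff (R S n) i
    confinedWalks≡coeff-R S-steps zero i i≥0 = begin
      confinedWalks zero origin i             ≡⟨ cong (_* 𝟙 (origin ≟e i)) (𝟙-yes (inOrthant? (origin {d})) origin-inOrthant) ⟩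
      1ℤ * 𝟙 (origin ≟e i)                    ≡⟨ ℤ.*-identityˡ _ ⟩
      𝟙 (origin ≟e i)                         ≡⟨ coeff-oneL i ⟨
      coeff oneL i                            ≡⟨ coeff-R-zero i i≥0 ⟨
      coeff (R S 0) i                         ∎
      where open ≡-Reasoning
    confinedWalks≡coeff-R S-steps (suc n) i i≥0 = begin
      confinedWalks (suc n) origin i              ≡⟨ confinedWalks-last-step n origin i ⟩
      𝟙 (inOrthant? i) * previous                 ≡⟨ cong (_* previous) (𝟙-yes (inOrthant? i) i≥0) ⟩
      1ℤ * previous                               ≡⟨ ℤ.*-identityˡ previous ⟩
      previous                                    ≡⟨ sumMap-cong S after-step ⟩
      sumMap S (λ s → coeff (R S n) (i -e s))     ≡⟨ coeff-R-suc n i ⟨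
      coeff (R S (suc n)) i                       ∎
      where
      open ≡-Reasoning
      previous : ℤ
      previous = sumMap S (λ s → confinedWalks n origin (i -e s))
      after-step : ∀ s → s ∈ S → confinedWalks n origin (i -e s) ≡ coeff (R S n) (i -e s)
      after-step s s∈S with inOrthant? (i -e s)
      ... | yes i-s≥0 = confinedWalks≡coeff-R S-steps n (i -e s) i-s≥0
      ... | no i-s≱0 with step-out-of-orthant i s i≥0 (All.lookup S-steps s∈S) i-s≱0
      ...   | k , i-sₖ≡-1 = trans (confinedWalks-outside n origin (i -e s) i-s≱0)
                                  (sym (coeff-R-on-wall n (i -e s) k i-sₖ≡-1))

lemma2p3 : (d : ℕ) → 1 ℕ.≤ d → (S : List (Exp d)) → Unique S → All.All IsStep S
    → (∀ s → s ∈ S → (k : Fin d) → flipE k s ∈ S)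
    → ((k : Fin d) → ∃[ s ] (s ∈ S × lookup s k ≡ 1ℤ))
    → (n : ℕ) (i : Exp d) → + (walkCount S n i) ≡ coeff (nonnegAll (R S n)) i
-- Neither d ≥ 1 nor the existence of a step with k-th coordinate 1 is needed for the identity.
lemma2p3 d _ S S-unique S-steps S-symmetric _ n i with inOrthant? i
... | yes i≥0 = begin
  + walkCount S n i                ≡⟨ walkCount≡confinedWalks S n i ⟩
  confinedWalks S n origin i       ≡⟨ confinedWalks≡coeff-R S S-unique S-symmetric S-steps n i i≥0 ⟩
  coeff (R S n) i                  ≡⟨ coeff-nonnegParts-≥ (allFin d) (R S n) i (VAll.lookup⁺ i≥0) ⟨
  coeff (nonnegAll (R S n)) i      ∎
  where open ≡-Reasoning
... | no i≱0 with ¬inOrthant⇒negative i i≱0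
...   | k , iₖ<0 = begin
  + walkCount S n i                ≡⟨ walkCount≡confinedWalks S n i ⟩
  confinedWalks S n origin i       ≡⟨ confinedWalks-outside S n origin i i≱0 ⟩
  0ℤ                               ≡⟨ coeff-nonnegParts-< (allFin d) (R S n) i k (∈.∈-allFin k) iₖ<0 ⟨
  coeff (nonnegAll (R S n)) i      ∎
  where open ≡-Reasoning
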